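{- Let $L$ be a language with $L\in\mathrm{Alt}(f)$ for some $f:\mathbb{N}\to\mathbb{N}$. Then there exists a constant $C$ such that for all $n\in\mathbb{N}$, the query table of $L$ of order $n$ has size at most $2^{C\cdot f(n)}$.
   Context: For a language $L$ and word $u$, the left quotient is $u^{ -1}L = \{v \mid uv\in L\}$; if $|u|\le n$ it is called a left quotient of $L$ of order $n$. For a family of languages $\mathcal{L}$ over alphabet $A$ and a word $w\in A^*$, the $\mathcal{L}$-profile of $w$ is the boolean vector indexed by $\mathcal{L}$ whose entry at $M\in\mathcal{L}$ states whether $w\in M$; the size of the query table of $\mathcal{L}$ is the number of distinct $\mathcal{L}$-profiles over all words. The query table of $L$ of order $n$ is the query table of the family of left quotients of $L$ of order $n$. An alternating machine over a finite alphabet $A$ consists of a (possibly infinite) set of states $Q$, an initial state $q_0\in Q$, a transition function $\delta: Q\times A\to\mathcal{B}^+(Q)$ (positive boolean formulae over $Q$) and a set $F\subseteq Q$ of accepting states. For an input word $w$, the acceptance game $\mathcal{G}_{\mathcal{A},w}$ is played by Prover and Verifier: starting in $q_0$, the letters of $w$ are read from left to right; in state $q$ reading letter $a$, the next state is obtained from the formula $\delta(q,a)$, Prover resolving disjunctions and Verifier resolving conjunctions. Prover wins a play if it ends in a state of $F$. The word $w$ is accepted if Prover has a winning strategy; the language recognised is the set of accepted words. For $f:\mathbb{N}\to\mathbb{N}$, a language $L$ is in $\mathrm{Alt}(f)$ if there are an alternating machine recognising $L$ and a constant $C$ such that for all $n\in\mathbb{N}$, the number of states $q$ for which there exists a word $w$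 of length at most $n$ with $q$ appearing in the game $\mathcal{G}_{\mathcal{A},w}$ is at most $C\cdot f(n)$. -}

module Defs where

open import Data.Nat using (ℕ; _≤_; _*_)
open import Data.Fin using (Fin)
open import Data.List using (List; []; _∷_; _++_; length; lookup)
open import Data.List.Membership.Propositional using (_∈_)
open import Data.Product using (Σ; ∃; _×_; _,_)
open import Data.Sum using (_⊎_)
open import Data.Unit using (⊤)
open import Data.Empty using (⊥)
open import Function.Bundles using (_⇔_)
open import Relation.Binary.PropositionalEquality using (_≡_; _≢_)
open import Relation.Nullary using (¬_)

Language : Set → Set₁
Language A = List A → Set

LeftQuotient : {A : Set} → Language A → List A → Language A
LeftQuotient L u v = L (u ++ v)

SameProfile : {A : Set} → Language A → ℕ → List A → List A → Set
SameProfile L n w w' =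
  (u : List _) → length u ≤ n → (LeftQuotient L u w ⇔ LeftQuotient L u w')

-- "the query table of L of order n has size at most N":
-- any list of words with pairwise distinct profiles has length at most N
QueryTableSizeAtMost : {A : Set} → Language A → ℕ → ℕ → Set
QueryTableSizeAtMost {A} L n N =
  (ws : List (List A)) →
  ((i j : Fin (length ws)) → i ≢ j →
     ¬ SameProfile L n (lookup ws i) (lookup ws j)) →
  length ws ≤ N

data PBF (Q : Set) : Set where
  atom : Q → PBF Q
  tt   : PBF Q
  ff   : PBF Q
  _∧_  : PBF Q → PBF Q → PBF Q
  _∨_  : PBF Q → PBF Q → PBF Q

-- q occurs as an atom of φ (i.e. can be reached in the game on φ)
_∈at_ : {Q : Set} → Q → PBF Q → Set
q ∈at atom p = q ≡ p
q ∈at tt     = ⊥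
q ∈at ff     = ⊥
q ∈at (φ ∧ ψ) = q ∈at φ ⊎ q ∈at ψ
q ∈at (φ ∨ ψ) = q ∈at φ ⊎ q ∈at ψ

-- Prover wins the sub-game on φ, given which next states are winning:
-- Prover resolves ∨, Verifier resolves ∧
Eval : {Q : Set} → (Q → Set) → PBF Q → Set
Eval W (atom q) = W q
Eval W tt       = ⊤
Eval W ff       = ⊥
Eval W (φ ∧ ψ)  = Eval W φ × Eval W ψ
Eval W (φ ∨ ψ)  = Eval W φ ⊎ Eval W ψ

record AltMachine (A : Set) : Set₁ where
  field
    Q   : Set
    q₀  : Q
    δ   : Q → A → PBF Q
    Acc : Q → Set

module _ {A : Set} (M : AltMachine A) where
  open AltMachine M

  -- Prover has a winning strategy in the acceptance game from state q
  -- with remaining input w (finite game: backward induction)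
  Win : Q → List A → Set
  Win q []      = Acc q
  Win q (a ∷ w) = Eval (λ q' → Win q' w) (δ q a)

  Accepts : List A → Set
  Accepts w = Win q₀ w

  ReachFrom : Q → List A → Q → Set
  ReachFrom p []      q = q ≡ p
  ReachFrom p (a ∷ u) q = Σ Q λ p' → p' ∈at δ p a × ReachFrom p' u q

  AppearsIn : List A → Q → Set
  AppearsIn w q = Σ (List A) λ u → Σ (List A) λ v → (u ++ v ≡ w) × ReachFrom q₀ u q

  AppearsUpTo : ℕ → Q → Set
  AppearsUpTo n q = Σ (List A) λ w → length w ≤ n × AppearsIn w q

Recognises : {A : Set} → AltMachine A → Language A → Set
Recognises M L = (w : List _) → L w ⇔ Accepts M w

AtMost : {X : Set} → (X → Set) → ℕ → Set
AtMost {X} P k = Σ (List X) λ xs → length xs ≤ k × ((x : X) → P x → x ∈ xs)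

InAlt : {A : Set} → (ℕ → ℕ) → Language A → Set₁
InAlt {A} f L =
  Σ (AltMachine A) λ M → Recognises M L ×
    ∃ λ C → (n : ℕ) → AtMost (AppearsUpTo M n) (C * f n)

module Submission where

-- Whether Prover wins from a state depends only on the state and the remaining
-- input, and a word u ++ w is accepted iff Prover wins the game on w from the
-- positions reachable by u.  Hence the profile of w with respect to the left
-- quotients of order n is determined by the set of states, among the at most
-- C f(n) states appearing in games on words of length ≤ n, from which Prover
-- wins on w; there are at most 2^(C f(n)) such sets.  The argument is
-- constructive up to double negation: since the bound is a decidable statement
-- about ℕ, it suffices to refute its failure, and under a double negation the
-- finitely many winning-or-not questions may be decided.

open import Defs
open import Data.Nat using (ℕ; zero; suc; _*_; _^_; _<_; _≤?_)
open import Data.Nat.Properties using (≤-trans; ^-monoʳ-≤; ≰⇒>)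
open import Data.Fin using (Fin; zero; suc)
open import Data.Fin.Base using (funToFin; finToFun)
open import Data.Fin.Properties using (pigeonhole; finToFun-funToFin; <⇒≢)
open import Data.Product using (∃; ∃₂; _×_; _,_)
open import Data.Sum using (inj₁; inj₂)
open import Data.List using (List; []; _∷_; _++_; length; lookup)
open import Data.List.Properties using (++-identityʳ)
open import Data.List.Membership.Propositional using (_∈_)
open import Data.List.Relation.Unary.Any using (index)
open import Data.List.Relation.Unary.Any.Properties using (lookup-index)
open import Data.Empty using (⊥-elim)
open import Data.Product.Function.NonDependent.Propositional using (_×-⇔_)
open import Data.Sum.Function.Propositional using (_⊎-⇔_)
open import Function.Base using (_∘_)
open import Function.Bundles using (_⇔_; mk⇔)
import Function.Properties.Equivalence as ⇔
open import Relation.Nullary using (¬_; Dec; yes; no)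
open import Relation.Nullary.Decidable using (¬¬-excluded-middle)
open import Relation.Binary.PropositionalEquality
  using (_≡_; _≢_; refl; sym; cong; subst; module ≡-Reasoning)
open ≡-Reasoning

¬¬-Π-Fin : {n : ℕ} {P : Fin n → Set} → ((i : Fin n) → ¬ ¬ P i) → ¬ ¬ ((i : Fin n) → P i)
¬¬-Π-Fin {zero}  ¬¬P k = k (λ ())
¬¬-Π-Fin {suc n} ¬¬P k =
  ¬¬-Π-Fin (λ i → ¬¬P (suc i)) λ Psuc → ¬¬P zero λ Pzero →
    k (λ { zero → Pzero ; (suc i) → Psuc i })

decToFin2 : {P : Set} → Dec P → Fin 2
decToFin2 (yes _) = zero
decToFin2 (no _)  = suc zero

decToFin2-≡⇒⇔ : {P R : Set} (p? : Dec P) (r? : Dec R) → decToFin2 p? ≡ decToFin2 r? → P ⇔ R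
decToFin2-≡⇒⇔ (yes p) (yes r) _ = mk⇔ (λ _ → r) (λ _ → p)
decToFin2-≡⇒⇔ (no ¬p) (no ¬r) _ = mk⇔ (λ p → ⊥-elim (¬p p)) (λ r → ⊥-elim (¬r r))

funToFin-injective : {m n : ℕ} {f g : Fin m → Fin n} → funToFin f ≡ funToFin g → (i : Fin m) → f i ≡ g i
funToFin-injective {f = f} {g} eq i = begin
  f i                     ≡⟨ sym (finToFun-funToFin f i) ⟩
  finToFun (funToFin f) i ≡⟨ cong (λ c → finToFun c i) eq ⟩
  finToFun (funToFin g) i ≡⟨ finToFun-funToFin g i ⟩
  g i                     ∎

pigeonhole-⇔ : {a m : ℕ} (P : Fin a → Fin m → Set) → 2 ^ m < a →
  ¬ ¬ ∃₂ λ i j → i ≢ j × ((q : Fin m) → P i q ⇔ P j q)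
pigeonhole-⇔ P 2^m<a k =
  ¬¬-Π-Fin (λ i → ¬¬-Π-Fin (λ q → ¬¬-excluded-middle {A = P i q})) λ P? →
    let i , j , i<j , eq = pigeonhole 2^m<a (λ i → funToFin (λ q → decToFin2 (P? i q)))
    in k (i , j , <⇒≢ i<j ,
          λ q → decToFin2-≡⇒⇔ (P? i q) (P? j q) (funToFin-injective eq q))

module _ {A : Set} (M : AltMachine A) where
  open AltMachine M

  Eval-cong : {W W′ : Q → Set} (φ : PBF Q) → ((q : Q) → q ∈at φ → W q ⇔ W′ q) →
    Eval W φ ⇔ Eval W′ φ
  Eval-cong (atom p) h = h p refl
  Eval-cong tt       h = ⇔.refl
  Eval-cong ff       h = ⇔.refl
  Eval-cong (φ ∧ ψ)  h = Eval-cong φ (λ q → h q ∘ inj₁) ×-⇔ Eval-cong ψ (λ q → h q ∘ inj₂)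
  Eval-cong (φ ∨ ψ)  h = Eval-cong φ (λ q → h q ∘ inj₁) ⊎-⇔ Eval-cong ψ (λ q → h q ∘ inj₂)

  Win-++-cong : (p : Q) (u : List A) {w w′ : List A} →
    ((q : Q) → ReachFrom M p u q → Win M q w ⇔ Win M q w′) →
    Win M p (u ++ w) ⇔ Win M p (u ++ w′)
  Win-++-cong p []      h = h p refl
  Win-++-cong p (a ∷ u) h =
    Eval-cong (δ p a) (λ p′ p′∈δ → Win-++-cong p′ u (λ q r → h q (p′ , p′∈δ , r)))

  sameProfile-if-Win-⇔ : {L : Language A} → Recognises M L → {n : ℕ} {w w′ : List A} →
    ((q : Q) → AppearsUpTo M n q → Win M q w ⇔ Win M q w′) →
    SameProfile L n w w′
  sameProfile-if-Win-⇔ recognises {w = w} {w′} h u |u|≤n =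
    ⇔.trans (recognises (u ++ w))
      (⇔.trans (Win-++-cong q₀ u (λ q r → h q (u , |u|≤n , u , [] , ++-identityʳ u , r)))
        (⇔.sym (recognises (u ++ w′))))

  queryTableSize-≤-2^states : {L : Language A} → Recognises M L → {n m : ℕ} →
    AtMost (AppearsUpTo M n) m → QueryTableSizeAtMost L n (2 ^ m)
  queryTableSize-≤-2^states recognises {n} (qs , |qs|≤m , covers) ws distinct
    with length ws ≤? 2 ^ length qs
  ... | yes |ws|≤ = ≤-trans |ws|≤ (^-monoʳ-≤ 2 |qs|≤m)
  ... | no  |ws|≰ =
    ⊥-elim (pigeonhole-⇔ winsAt (≰⇒> |ws|≰) λ (i , j , i≢j , same) →
      distinct i j i≢j (sameProfile-if-Win-⇔ recognises (agreeOnAppearing same)))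
    where
    winsAt : Fin (length ws) → Fin (length qs) → Set
    winsAt i j = Win M (lookup qs j) (lookup ws i)

    agreeOnAppearing : {i j : Fin (length ws)} → ((x : Fin (length qs)) → winsAt i x ⇔ winsAt j x) →
      (q : Q) → AppearsUpTo M n q → Win M q (lookup ws i) ⇔ Win M q (lookup ws j)
    agreeOnAppearing {i} {j} same q appears =
      subst (λ q′ → Win M q′ (lookup ws i) ⇔ Win M q′ (lookup ws j))
            (sym (lookup-index q∈qs)) (same (index q∈qs))
      where
      q∈qs : q ∈ qs
      q∈qs = covers q appears

theorem3 : {k : ℕ} (L : Language (Fin k)) (f : ℕ → ℕ) → InAlt f L →
    ∃ λ C → (n : ℕ) → QueryTableSizeAtMost L n (2 ^ (C * f n))
theorem3 L f (M , recognises , C , fewStates) =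
  C , λ n → queryTableSize-≤-2^states M recognises (fewStates n)
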